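{- Let $K_{m,n}$ be the complete bipartite graph with $n\geq m\geq 2$. Then $\gamma(C(K_{m,n}))=m+1$.
   Context: The central graph $C(G)$ of a simple graph $G$ is obtained from $G$ by subdividing each edge of $G$ exactly once and joining every pair of vertices non-adjacent in $G$ by an edge. $\gamma$ denotes the domination number. -}

module Defs where

open import Data.Nat using (ℕ; _+_; _<_; _≤_)
open import Data.Fin using (Fin; toℕ)
import Data.Fin as F
open import Data.Product using (Σ; _×_; ∃; _,_)
open import Data.Sum using (_⊎_)
open import Data.List using (List; length)
open import Data.List.Membership.Propositional using (_∈_)
open import Data.List.Relation.Unary.Any using (Any)
open import Relation.Binary.PropositionalEquality using (_≡_; _≢_)
open import Relation.Nullary using (¬_)

record Graph (n : ℕ) : Set₁ where
  field
    Adj   : Fin n → Fin n → Set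
    sym   : ∀ {u v} → Adj u v → Adj v u
    irrefl : ∀ {u} → ¬ Adj u u
open Graph public

record RawGraph : Set₁ where
  field
    Vtx : Set
    _~_ : Vtx → Vtx → Set
open RawGraph public

-- Vertices of the central graph C(G): original vertices, and one new
-- vertex per edge {u,v} of G (represented with u < v, so each edge once).
data CVertex {n : ℕ} (G : Graph n) : Set where
  orig : Fin n → CVertex G
  sub  : (u v : Fin n) → u F.< v → Adj G u v → CVertex G

-- Adjacency in C(G): each edge uv is subdivided (u – s_uv – v),
-- original edges are removed, and non-adjacent distinct vertices are joined.
data CAdj {n : ℕ} (G : Graph n) : CVertex G → CVertex G → Set where
  orig-orig : ∀ {u v} → u ≢ v → ¬ Adj G u v → CAdj G (orig u) (orig v)
  orig-subˡ : ∀ {u v p e} → CAdj G (orig u) (sub u v p e)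
  orig-subʳ : ∀ {u v p e} → CAdj G (orig v) (sub u v p e)
  subˡ-orig : ∀ {u v p e} → CAdj G (sub u v p e) (orig u)
  subʳ-orig : ∀ {u v p e} → CAdj G (sub u v p e) (orig v)

central : ∀ {n} → Graph n → RawGraph
central G = record { Vtx = CVertex G ; _~_ = CAdj G }

Dominating : (H : RawGraph) → List (Vtx H) → Set
Dominating H D = ∀ x → x ∈ D ⊎ Any (λ d → _~_ H d x) D

-- γ(H) ≡ k: a dominating set of size k exists and none is smaller.
-- (Sets are lists; duplicates only increase length, so the minimum is the same.)
DominationNumber : RawGraph → ℕ → Set
DominationNumber H k =
  (Σ (List (Vtx H)) λ D → Dominating H D × length D ≡ k)
  × (∀ D → Dominating H D → k ≤ length D)

KAdj : (m n : ℕ) → Fin (m + n) → Fin (m + n) → Set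
KAdj m n u v = (toℕ u < m × m ≤ toℕ v) ⊎ (toℕ v < m × m ≤ toℕ u)

open import Data.Sum using (inj₁; inj₂)
open import Data.Nat.Properties using (<⇒≱)

K : (m n : ℕ) → Graph (m + n)
K m n = record
  { Adj = KAdj m n
  ; sym = λ { (inj₁ (a , b)) → inj₂ (a , b) ; (inj₂ (a , b)) → inj₁ (a , b) }
  ; irrefl = λ { (inj₁ (a , b)) → <⇒≱ a b ; (inj₂ (a , b)) → <⇒≱ a b }
  }

{-# OPTIONS --safe #-}
module Submission where

-- Upper bound: part A together with any one vertex b of part B dominates C(K_{m,n}),
-- since every subdivision vertex lies next to an A-vertex and b is joined to the rest of B.
-- Lower bound: if D contains all of A, the B-vertex b still needs a dominator outside A,
-- as its A-neighbours in K_{m,n} are not its neighbours in C(K_{m,n}).  Otherwise some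
-- a ∈ A is missing from D, and for each b ∈ B the subdivision vertex of ab forces b or
-- that vertex into D: n distinct elements.  The dominator of a itself is one more, unless
-- it is the subdivision vertex of some ab with b ∉ D; then the subdivision vertex of a′b
-- for a second a′ ∈ A forces a′ or that vertex into D instead.  So |D| ≥ min(m, n) + 1.

open import Defs hiding (sym)
open import Data.Nat using (ℕ; zero; suc; _+_; _≤_; _<_; s≤s)
open import Data.Nat.Properties using (<⇒≱; <-≤-trans; ≤-<-trans; m≤m+n; +-comm)
open import Data.Fin as F using (Fin; toℕ; _↑ˡ_; _↑ʳ_; splitAt)
open import Data.Fin.Properties as FP
  using (toℕ-↑ˡ; toℕ-↑ʳ; ↑ˡ-injective; ↑ʳ-injective; splitAt⁻¹-↑ˡ; splitAt⁻¹-↑ʳ; injective⇒≤; all?; ¬∀⟶∃¬)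
open import Data.List using (List; _∷_; length; tabulate; lookup)
open import Data.List.Properties using (length-tabulate)
open import Data.List.Relation.Unary.Any using (here; there; index; any?)
open import Data.List.Relation.Unary.Any.Properties using (lookup-index)
open import Data.List.Membership.Propositional using (_∈_; find; lose)
open import Data.List.Membership.Propositional.Properties using (∈-tabulate⁺)
open import Data.Product using (Σ; _×_; _,_; proj₁; proj₂)
open import Data.Sum using (_⊎_; inj₁; inj₂)
open import Data.Empty using (⊥-elim)
open import Function.Definitions using (Injective)
open import Relation.Nullary using (¬_; Dec; yes; no)
open import Relation.Nullary.Decidable using (map′)
open import Relation.Binary.PropositionalEquality using (_≡_; _≢_; refl; sym; trans; cong; subst; module ≡-Reasoning)

module _ {A : Set} (D : List A) where

  injective-members⇒≤-length : ∀ {k} {g : Fin k → A} → Injective _≡_ _≡_ g →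
    (∀ i → g i ∈ D) → k ≤ length D
  injective-members⇒≤-length {g = g} g-inj g∈D = injective⇒≤ position-injective
    where
    position-injective : Injective _≡_ _≡_ (λ i → index (g∈D i))
    position-injective {i} {j} eq = g-inj (begin
      g i                     ≡⟨ lookup-index (g∈D i) ⟩
      lookup D (index (g∈D i)) ≡⟨ cong (lookup D) eq ⟩
      lookup D (index (g∈D j)) ≡⟨ sym (lookup-index (g∈D j)) ⟩
      g j                     ∎)
      where open ≡-Reasoning

  injective-members+fresh⇒<-length : ∀ {k} {g : Fin k → A} → Injective _≡_ _≡_ g →
    (∀ i → g i ∈ D) → ∀ {e} → e ∈ D → (∀ i → g i ≢ e) → k < length D
  injective-members+fresh⇒<-length {k} {g} g-inj g∈D {e} e∈D g≢e =
    injective-members⇒≤-length {g = g′} g′-inj g′∈D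
    where
    g′ : Fin (suc k) → A
    g′ F.zero    = e
    g′ (F.suc i) = g i

    g′-inj : Injective _≡_ _≡_ g′
    g′-inj {F.zero}  {F.zero}  _  = refl
    g′-inj {F.zero}  {F.suc j} eq = ⊥-elim (g≢e j (sym eq))
    g′-inj {F.suc i} {F.zero}  eq = ⊥-elim (g≢e i eq)
    g′-inj {F.suc i} {F.suc j} eq = cong F.suc (g-inj eq)

    g′∈D : ∀ i → g′ i ∈ D
    g′∈D F.zero    = e∈D
    g′∈D (F.suc i) = g∈D i

module _ {k} {G : Graph k} where

  orig-injective : ∀ {u w} → orig {G = G} u ≡ orig w → u ≡ w
  orig-injective refl = refl

  endˡ endʳ : CVertex G → Fin k
  endˡ (orig u)      = u
  endˡ (sub u _ _ _) = u
  endʳ (orig u)      = u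
  endʳ (sub _ v _ _) = v

  orig∈? : ∀ u (D : List (CVertex G)) → Dec (orig u ∈ D)
  orig∈? u = any? orig≟
    where
    orig≟ : ∀ x → Dec (orig u ≡ x)
    orig≟ (orig w) = map′ (cong orig) orig-injective (u F.≟ w)
    orig≟ (sub _ _ _ _) = no λ ()

  sub-dominated : ∀ {D} → Dominating (central G) D → ∀ {u v p e} →
    sub u v p e ∈ D ⊎ orig u ∈ D ⊎ orig v ∈ D
  sub-dominated {D} dom {u} {v} {p} {e} with dom (sub u v p e)
  ... | inj₁ s∈D = inj₁ s∈D
  ... | inj₂ neighbour with find neighbour
  ...   | _ , u∈D , orig-subˡ = inj₂ (inj₁ u∈D)
  ...   | _ , v∈D , orig-subʳ = inj₂ (inj₂ v∈D)

module CentralBipartite (m n : ℕ) where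

  V : Set
  V = CVertex (K m n)

  data Part : Fin (m + n) → Set where
    inA : (i : Fin m) → Part (i ↑ˡ n)
    inB : (j : Fin n) → Part (m ↑ʳ j)

  part : ∀ u → Part u
  part u with splitAt m u in eq
  ... | inj₁ i = subst Part (splitAt⁻¹-↑ˡ eq) (inA i)
  ... | inj₂ j = subst Part (splitAt⁻¹-↑ʳ eq) (inB j)

  ↑ˡ<m : (i : Fin m) → toℕ (i ↑ˡ n) < m
  ↑ˡ<m i = subst (_< m) (sym (toℕ-↑ˡ i n)) (FP.toℕ<n i)

  m≤↑ʳ : (j : Fin n) → m ≤ toℕ (m ↑ʳ j)
  m≤↑ʳ j = subst (m ≤_) (sym (toℕ-↑ʳ m j)) (m≤m+n m (toℕ j))

  ↑ˡ<↑ʳ : (i : Fin m) (j : Fin n) → i ↑ˡ n F.< m ↑ʳ j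
  ↑ˡ<↑ʳ i j = <-≤-trans (↑ˡ<m i) (m≤↑ʳ j)

  ↑ˡ≢↑ʳ : (i : Fin m) (j : Fin n) → i ↑ˡ n ≢ m ↑ʳ j
  ↑ˡ≢↑ʳ i j = FP.<⇒≢ (↑ˡ<↑ʳ i j)

  Adj-↑ˡ-↑ʳ : (i : Fin m) (j : Fin n) → KAdj m n (i ↑ˡ n) (m ↑ʳ j)
  Adj-↑ˡ-↑ʳ i j = inj₁ (↑ˡ<m i , m≤↑ʳ j)

  ¬Adj-↑ˡ-↑ˡ : (i i′ : Fin m) → ¬ KAdj m n (i ↑ˡ n) (i′ ↑ˡ n)
  ¬Adj-↑ˡ-↑ˡ i i′ (inj₁ (_ , m≤i′)) = <⇒≱ (↑ˡ<m i′) m≤i′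
  ¬Adj-↑ˡ-↑ˡ i i′ (inj₂ (_ , m≤i))  = <⇒≱ (↑ˡ<m i) m≤i

  ¬Adj-↑ʳ-↑ʳ : (j j′ : Fin n) → ¬ KAdj m n (m ↑ʳ j) (m ↑ʳ j′)
  ¬Adj-↑ʳ-↑ʳ j j′ (inj₁ (j<m , _)) = <⇒≱ j<m (m≤↑ʳ j)
  ¬Adj-↑ʳ-↑ʳ j j′ (inj₂ (j′<m , _)) = <⇒≱ j′<m (m≤↑ʳ j′)

  A-vertex : Fin m → V
  A-vertex i = orig (i ↑ˡ n)

  B-vertex : Fin n → V
  B-vertex j = orig (m ↑ʳ j)

  A-vertex-injective : Injective _≡_ _≡_ A-vertex
  A-vertex-injective eq = ↑ˡ-injective n _ _ (orig-injective eq)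

  A-vertices : List V
  A-vertices = tabulate A-vertex

  length-B-vertex∷A-vertices : ∀ j → length (B-vertex j ∷ A-vertices) ≡ m + 1
  length-B-vertex∷A-vertices j = trans (cong suc (length-tabulate A-vertex)) (+-comm 1 m)

  B-vertex∷A-vertices-dominating : ∀ j → Dominating (central (K m n)) (B-vertex j ∷ A-vertices)
  B-vertex∷A-vertices-dominating j (orig u) with part u
  ... | inA i = inj₁ (there (∈-tabulate⁺ i))
  ... | inB j′ with j′ F.≟ j
  ...   | yes refl = inj₁ (here refl)
  ...   | no j′≢j  = inj₂ (here (orig-orig (λ eq → j′≢j (sym (↑ʳ-injective m j j′ eq)))
                                             (¬Adj-↑ʳ-↑ʳ j j′)))
  B-vertex∷A-vertices-dominating j (sub u v _ uv) with part u | part v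
  ... | inA i  | _      = inj₂ (lose (there (∈-tabulate⁺ i)) orig-subˡ)
  ... | inB _  | inA i  = inj₂ (lose (there (∈-tabulate⁺ i)) orig-subʳ)
  ... | inB j₁ | inB j₂ = ⊥-elim (¬Adj-↑ʳ-↑ʳ j₁ j₂ uv)

  module _ {D : List V} (dom : Dominating (central (K m n)) D) where

    B-neighbour≢A-vertex : ∀ {d} j → CAdj (K m n) d (B-vertex j) → ∀ i → A-vertex i ≢ d
    B-neighbour≢A-vertex j (orig-orig _ ¬adj) i refl = ¬adj (Adj-↑ˡ-↑ʳ i j)
    B-neighbour≢A-vertex j subˡ-orig i ()
    B-neighbour≢A-vertex j subʳ-orig i ()

    A-vertices⊆D⇒m<length : (∀ i → A-vertex i ∈ D) → Fin n → m < length D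
    A-vertices⊆D⇒m<length A⊆D j with dom (B-vertex j)
    ... | inj₁ b∈D = injective-members+fresh⇒<-length D A-vertex-injective A⊆D b∈D
                       (λ i eq → ↑ˡ≢↑ʳ i j (orig-injective eq))
    ... | inj₂ neighbour with find neighbour
    ...   | _ , d∈D , d~b = injective-members+fresh⇒<-length D A-vertex-injective A⊆D d∈D
                              (B-neighbour≢A-vertex j d~b)

    module _ (a : Fin m) (a∉D : ¬ A-vertex a ∈ D) (a′ : Fin m) (a′≢a : a′ ≢ a) where

      data Represents (j : Fin n) : V → Set where
        vertex : Represents j (B-vertex j)
        edge   : ¬ B-vertex j ∈ D → Represents j (sub (a ↑ˡ n) (m ↑ʳ j) (↑ˡ<↑ʳ a j) (Adj-↑ˡ-↑ʳ a j))

      endʳ-represents : ∀ {j x} → Represents j x → endʳ x ≡ m ↑ʳ j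
      endʳ-represents vertex   = refl
      endʳ-represents (edge _) = refl

      represented-in-D : ∀ j → Σ V λ x → x ∈ D × Represents j x
      represented-in-D j with orig∈? (m ↑ʳ j) D
      ... | yes b∈D = _ , b∈D , vertex
      ... | no b∉D with sub-dominated dom {a ↑ˡ n} {m ↑ʳ j} {↑ˡ<↑ʳ a j} {Adj-↑ˡ-↑ʳ a j}
      ...   | inj₁ s∈D        = _ , s∈D , edge b∉D
      ...   | inj₂ (inj₁ a∈D) = ⊥-elim (a∉D a∈D)
      ...   | inj₂ (inj₂ b∈D) = ⊥-elim (b∉D b∈D)

      representative : Fin n → V
      representative j = proj₁ (represented-in-D j)

      representative∈D : ∀ j → representative j ∈ D
      representative∈D j = proj₁ (proj₂ (represented-in-D j))

      representative-represents : ∀ j → Represents j (representative j)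
      representative-represents j = proj₂ (proj₂ (represented-in-D j))

      representative-injective : Injective _≡_ _≡_ representative
      representative-injective {j} {j′} eq = ↑ʳ-injective m j j′ (begin
        m ↑ʳ j                  ≡⟨ sym (endʳ-represents (representative-represents j)) ⟩
        endʳ (representative j)  ≡⟨ cong endʳ eq ⟩
        endʳ (representative j′) ≡⟨ endʳ-represents (representative-represents j′) ⟩
        m ↑ʳ j′                 ∎)
        where open ≡-Reasoning

      Fresh : V → Set
      Fresh e = ∀ {j x} → Represents j x → x ≢ e

      A-vertex-fresh : ∀ i → Fresh (A-vertex i)
      A-vertex-fresh i {j} vertex eq = ↑ˡ≢↑ʳ i j (sym (orig-injective eq))
      A-vertex-fresh i (edge _) ()

      edge-fresh : ∀ {v p q} → orig v ∈ D → Fresh (sub (a ↑ˡ n) v p q)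
      edge-fresh v∈D vertex      ()
      edge-fresh v∈D (edge b∉D) refl = b∉D v∈D

      a′-edge-fresh : ∀ {v p q} → Fresh (sub (a′ ↑ˡ n) v p q)
      a′-edge-fresh vertex   ()
      a′-edge-fresh (edge _) eq = a′≢a (↑ˡ-injective n a′ a (sym (cong endˡ eq)))

      FreshMember : Set
      FreshMember = Σ V λ e → e ∈ D × Fresh e

      fresh-member-beside-edge : ∀ j {p q} → sub (a ↑ˡ n) (m ↑ʳ j) p q ∈ D → FreshMember
      fresh-member-beside-edge j s∈D with orig∈? (m ↑ʳ j) D
      ... | yes b∈D = _ , s∈D , edge-fresh b∈D
      ... | no b∉D with sub-dominated dom {a′ ↑ˡ n} {m ↑ʳ j} {↑ˡ<↑ʳ a′ j} {Adj-↑ˡ-↑ʳ a′ j}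
      ...   | inj₁ s′∈D        = _ , s′∈D , a′-edge-fresh
      ...   | inj₂ (inj₁ a′∈D) = _ , a′∈D , A-vertex-fresh a′
      ...   | inj₂ (inj₂ b∈D)  = ⊥-elim (b∉D b∈D)

      fresh-member-from-neighbour : ∀ {d} → d ∈ D → CAdj (K m n) d (A-vertex a) → FreshMember
      fresh-member-from-neighbour d∈D (orig-orig {u = u} _ ¬adj) with part u
      ... | inA i = _ , d∈D , A-vertex-fresh i
      ... | inB j = ⊥-elim (¬adj (inj₂ (↑ˡ<m a , m≤↑ʳ j)))
      fresh-member-from-neighbour d∈D (subˡ-orig {v = v} {e = av}) with part v
      ... | inA i = ⊥-elim (¬Adj-↑ˡ-↑ˡ a i av)
      ... | inB j = fresh-member-beside-edge j d∈D
      fresh-member-from-neighbour d∈D (subʳ-orig {u = u} {p = u<a} {e = ua}) with part u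
      ... | inA i = ⊥-elim (¬Adj-↑ˡ-↑ˡ i a ua)
      ... | inB j = ⊥-elim (FP.<-asym u<a (↑ˡ<↑ʳ a j))

      fresh-member : FreshMember
      fresh-member with dom (A-vertex a)
      ... | inj₁ a∈D = ⊥-elim (a∉D a∈D)
      ... | inj₂ neighbour with find neighbour
      ...   | _ , d∈D , d~a = fresh-member-from-neighbour d∈D d~a

      A-vertex∉D⇒n<length : n < length D
      A-vertex∉D⇒n<length with fresh-member
      ... | _ , e∈D , e-fresh = injective-members+fresh⇒<-length D representative-injective
          representative∈D e∈D (λ j → e-fresh (representative-represents j))

    dominating⇒m<length : Fin n → m ≤ n → (∀ (a : Fin m) → Σ (Fin m) (_≢ a)) → m < length D
    dominating⇒m<length j m≤n another with all? (λ i → orig∈? (i ↑ˡ n) D)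
    ... | yes A⊆D = A-vertices⊆D⇒m<length A⊆D j
    ... | no A⊈D with ¬∀⟶∃¬ m _ (λ i → orig∈? (i ↑ˡ n) D) A⊈D
    ...   | a , a∉D with another a
    ...     | a′ , a′≢a = ≤-<-trans m≤n (A-vertex∉D⇒n<length a a∉D a′ a′≢a)

another : ∀ {k} (a : Fin (suc (suc k))) → Σ (Fin (suc (suc k))) (_≢ a)
another F.zero    = F.suc F.zero , λ ()
another (F.suc _) = F.zero , λ ()

theorem4p3 : (m n : ℕ) → 2 ≤ m → m ≤ n →
    DominationNumber (central (K m n)) (m + 1)
theorem4p3 (suc (suc _)) zero (s≤s (s≤s _)) ()
theorem4p3 m@(suc (suc _)) n@(suc _) (s≤s (s≤s _)) m≤n =
  (B-vertex F.zero ∷ A-vertices , B-vertex∷A-vertices-dominating F.zero ,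
   length-B-vertex∷A-vertices F.zero) ,
  λ D dom → subst (_≤ length D) (+-comm 1 m) (dominating⇒m<length dom F.zero m≤n another)
  where open CentralBipartite m n
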